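{- Let $(G,\prec)$ be a Nyldon-like set over $A$. Then (1) every primitive word $w\in A^+$ has exactly one conjugate that lies in $G$; and (2) no nonempty non-primitive word lies in $G$.
   Context: $A$ is a finite alphabet with at least two letters. For $w\in A^+$, a $G$-factorization of $w$ is a sequence $(w_1,\dots,w_k)$, $k\ge 1$, of words of $G$ with $w=w_1w_2\cdots w_k$ and $w_1\preceq w_2\preceq\cdots\preceq w_k$. A Nyldon-like set is a pair $(G,\prec)$ with $G\subseteq A^+$ and $\prec$ a total order on $G$ such that: every letter of $A$ lies in $G$; a word $w$ of length at least $2$ lies in $G$ if and only if $w$ has no $G$-factorization with $k\ge 2$ factors; and for all $f,g\in G$ with $fg\in G$ we have $f\prec fg$. A word is primitive if it is not $u^k$ for any word $u$ and $k\ge 2$; $x$ is a conjugate of $w$ if $w=uv$ and $x=vu$ for some words $u,v$. -}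

module Defs where

open import Level using (Level; _⊔_; suc)
open import Data.Nat using (ℕ; _≥_)
open import Data.List using (List; []; _∷_; [_]; _++_; concat; replicate; length)
open import Data.List.Membership.Propositional using (_∈_)
open import Data.List.Relation.Unary.All using (All)
open import Data.Product using (Σ; ∃; ∃-syntax; _×_; _,_)
open import Data.Sum using (_⊎_)
open import Data.Empty using (⊥)
open import Relation.Nullary using (¬_)
open import Relation.Binary.PropositionalEquality using (_≡_; _≢_)

Word : Set → Set
Word A = List A

record Alphabet (A : Set) : Set where
  field
    letters   : List A
    complete  : ∀ (a : A) → a ∈ letters
    twoLetters : Σ A λ a → Σ A λ b → a ≢ b

_^ʷ_ : {A : Set} → Word A → ℕ → Word A
u ^ʷ k = concat (replicate k u)

Primitive : {A : Set} → Word A → Set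
Primitive w = (w ≢ []) × (¬ (Σ _ λ u → Σ ℕ λ k → (k ≥ 2) × (w ≡ u ^ʷ k)))

Conjugate : {A : Set} → Word A → Word A → Set
Conjugate w x = Σ _ λ u → Σ _ λ v → (w ≡ u ++ v) × (x ≡ v ++ u)

_⟨_⟩⪯_ : {A : Set} → Word A → (Word A → Word A → Set) → Word A → Set
f ⟨ _≺_ ⟩⪯ g = (f ≺ g) ⊎ (f ≡ g)

data Sorted {A : Set} (_≺_ : Word A → Word A → Set) : List (Word A) → Set where
  []  : Sorted _≺_ []
  [-] : ∀ {f} → Sorted _≺_ [ f ]
  _∷_ : ∀ {f g ws} → f ⟨ _≺_ ⟩⪯ g → Sorted _≺_ (g ∷ ws) → Sorted _≺_ (f ∷ g ∷ ws)

record GFactorization {A : Set} (G : Word A → Set) (_≺_ : Word A → Word A → Set)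
                      (w : Word A) : Set where
  field
    factors : List (Word A)
    inG     : All G factors
    product : concat factors ≡ w
    sorted  : Sorted _≺_ factors

numFactors : {A : Set} {G : Word A → Set} {_≺_ : Word A → Word A → Set} {w : Word A}
           → GFactorization G _≺_ w → ℕ
numFactors F = length (GFactorization.factors F)

record NyldonLike {A : Set} (G : Word A → Set) (_≺_ : Word A → Word A → Set) : Set where
  field
    nonempty    : ∀ {w} → G w → w ≢ []
    irrefl      : ∀ {f} → G f → ¬ (f ≺ f)
    trans       : ∀ {f g h} → G f → G g → G h → f ≺ g → g ≺ h → f ≺ h
    total       : ∀ {f g} → G f → G g → (f ≺ g) ⊎ (f ≡ g) ⊎ (g ≺ f)
    letters     : ∀ (a : A) → G [ a ]
    factorChar  : ∀ (w : Word A) → length w ≥ 2 →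
                    (G w → ¬ (Σ (GFactorization G _≺_ w) λ F → numFactors F ≥ 2))
                  × (¬ (Σ (GFactorization G _≺_ w) λ F → numFactors F ≥ 2) → G w)
    prefixLess  : ∀ {f g} → G f → G g → G (f ++ g) → f ≺ (f ++ g)

-- A word g ∈ G is ≻ each proper suffix s ∈ G of it: the last factor of a G-factorization of
-- the removed prefix must be ≻ s (else appending s factorizes g), and an induction on |g| and on
-- the removed prefix reduces to a prefix that itself lies in G, where prefixLess applies.
-- Hence, if a is the least letter of a word, a G-word all of whose letters are ⪰ a starts with a
-- only if it is a itself; the other such words are products of blocks b aⁱ with b ≻ a, and G read
-- on these products is again Nyldon-like over the alphabet of blocks (Lazard elimination).
-- Both claims then follow by induction on length through the elimination: nonempty u, v with
-- uv, vu ∈ G would yield shorter such words over blocks, and a primitive word has a rotation not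
-- starting with a whose block image is shorter and still primitive.  Powers uᵏ (k ≥ 2) are
-- excluded since u ⋅ uᵏ⁻¹ = uᵏ⁻¹ ⋅ u.

module Submission where

open import Defs
open import Data.Nat using (ℕ; zero; suc; _≤_; _<_; _≥_; z≤n; s≤s)
open import Data.Nat.Properties using (≤-trans; ≤-refl; ≤-<-trans; <-≤-trans; m≤n+m)
open import Data.Nat.Induction using (<-wellFounded)
open import Induction.WellFounded using (Acc; acc)
open import Data.List
  using (List; []; _∷_; [_]; _++_; concat; concatMap; map; replicate; length; _∷ʳ_; InitLast; initLast; _∷ʳ′_)
open import Data.List.Properties
  using (∷-injective; ∷-injectiveˡ; ++-assoc; ++-identityʳ; ++-conicalˡ; ++-conicalʳ; concat-++; concatMap-++;
         length-++; length-map; length-++-≤ˡ; length-++-≤ʳ)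
open import Data.List.Relation.Unary.All as All using (All; []; _∷_)
open import Data.List.Relation.Unary.Any using (here; there)
open import Data.List.Membership.Propositional using (_∈_)
open import Data.List.Relation.Unary.All.Properties using (++⁺; ++⁻ˡ; ++⁻ʳ; ∷ʳ⁻; replicate⁺; map⁺; map⁻)
open import Data.Product as Product using (Σ; ∃-syntax; _×_; _,_; proj₁; proj₂)
open import Data.Sum as Sum using (_⊎_; inj₁; inj₂)
open import Data.Empty using (⊥; ⊥-elim)
open import Relation.Nullary using (¬_; Dec; yes; no; contradiction)
open import Relation.Nullary.Decidable using (decidable-stable; True; toWitness; fromWitness)
open import Data.Bool.Properties using (T-irrelevant)
open import Relation.Binary.PropositionalEquality hiding ([_])
open import Data.List.Relation.Binary.Permutation.Propositional using (_↭_)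
open import Data.List.Relation.Binary.Permutation.Propositional.Properties
  using (All-resp-↭; ∈-resp-↭; ↭-length) renaming (++-comm to ↭-++-comm)
open import Function using (_∘_; _on_)

module _ {X : Set} where

  levi : ∀ (a b c d : List X) → a ++ b ≡ c ++ d →
         (∃[ p ] c ≡ a ++ p × b ≡ p ++ d) ⊎ (∃[ p ] a ≡ c ++ p × d ≡ p ++ b)
  levi []      b c       d eq = inj₁ (c , refl , eq)
  levi (x ∷ a) b []      d eq = inj₂ (x ∷ a , refl , sym eq)
  levi (x ∷ a) b (y ∷ c) d eq with refl , eq′ ← ∷-injective eq with levi a b c d eq′
  ... | inj₁ (p , c≡ap , b≡pd) = inj₁ (p , cong (x ∷_) c≡ap , b≡pd)
  ... | inj₂ (p , a≡cp , d≡pb) = inj₂ (p , cong (x ∷_) a≡cp , d≡pb)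

  ++≡⇒length-≤ˡ : ∀ {z : List X} x {y} → z ≡ x ++ y → length x ≤ length z
  ++≡⇒length-≤ˡ x refl = length-++-≤ˡ x

  ++≡⇒length-≤ʳ : ∀ {z : List X} x {y} → z ≡ x ++ y → length y ≤ length z
  ++≡⇒length-≤ʳ x {y} refl = length-++-≤ʳ y {x}

  ++≡⇒length-<ˡ : ∀ {z : List X} x {y} → z ≡ x ++ y → y ≢ [] → length x < length z
  ++≡⇒length-<ˡ x       {[]}    _    y≢[] = ⊥-elim (y≢[] refl)
  ++≡⇒length-<ˡ []      {_ ∷ _} refl _    = s≤s z≤n
  ++≡⇒length-<ˡ (_ ∷ x) {_ ∷ _} refl y≢[] = s≤s (++≡⇒length-<ˡ x refl y≢[])

  ++≡⇒length-<ʳ : ∀ {z : List X} x {y} → z ≡ x ++ y → x ≢ [] → length y < length z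
  ++≡⇒length-<ʳ []      _    x≢[] = ⊥-elim (x≢[] refl)
  ++≡⇒length-<ʳ (_ ∷ x) {y} refl _ = s≤s (length-++-≤ʳ y {x})

  concat-∷ʳ : ∀ (xss : List (List X)) xs → concat (xss ∷ʳ xs) ≡ concat xss ++ xs
  concat-∷ʳ xss xs = trans (sym (concat-++ xss [ xs ])) (cong (concat xss ++_) (++-identityʳ xs))

  length≤length-concat : ∀ {xss : List (List X)} → All (_≢ []) xss → length xss ≤ length (concat xss)
  length≤length-concat                 []               = z≤n
  length≤length-concat {[] ∷ _}        (≢[] ∷ _)        = contradiction refl ≢[]
  length≤length-concat {(_ ∷ xs) ∷ xss} (_ ∷ xss≢[]) =
    s≤s (≤-trans (length≤length-concat xss≢[]) (length-++-≤ʳ (concat xss) {xs}))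

  length-++-∷-∷ : ∀ (xs : List X) y z zs → 2 ≤ length (xs ++ y ∷ z ∷ zs)
  length-++-∷-∷ xs y z zs = subst (2 ≤_) (sym (length-++ xs))
                                  (≤-trans (s≤s (s≤s z≤n)) (m≤n+m _ (length xs)))

  Conjugate-refl : ∀ (w : List X) → Conjugate w w
  Conjugate-refl w = [] , w , refl , sym (++-identityʳ w)

  Conjugate-sym : ∀ {w x : List X} → Conjugate w x → Conjugate x w
  Conjugate-sym (u , v , w≡uv , x≡vu) = v , u , x≡vu , w≡uv

  Conjugate-trans : ∀ {w x y : List X} → Conjugate w x → Conjugate x y → Conjugate w y
  Conjugate-trans (u₁ , v₁ , refl , refl) (u₂ , v₂ , x≡ , refl) with levi v₁ u₁ u₂ v₂ x≡
  ... | inj₁ (p , refl , refl) = p , v₂ ++ v₁ , ++-assoc p v₂ v₁ , sym (++-assoc v₂ v₁ p)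
  ... | inj₂ (p , refl , refl) = u₁ ++ u₂ , p , sym (++-assoc u₁ u₂ p) , ++-assoc p u₁ u₂

  []^ʷ : ∀ k → [] ^ʷ k ≡ ([] {A = X})
  []^ʷ zero    = refl
  []^ʷ (suc k) = []^ʷ k

  ^ʷ-comm : ∀ (u : List X) k → u ^ʷ k ++ u ≡ u ++ u ^ʷ k
  ^ʷ-comm u zero    = sym (++-identityʳ u)
  ^ʷ-comm u (suc k) = trans (++-assoc u (u ^ʷ k) u) (cong (u ++_) (^ʷ-comm u k))

  replicate-^ʷ : ∀ i (x : X) → replicate i x ≡ [ x ] ^ʷ i
  replicate-^ʷ zero    _ = refl
  replicate-^ʷ (suc i) x = cong (x ∷_) (replicate-^ʷ i x)

  ^ʷ-rotate : ∀ c (t : List X) k → (c ∷ t) ^ʷ k ++ [ c ] ≡ c ∷ (t ++ [ c ]) ^ʷ k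
  ^ʷ-rotate c t zero    = refl
  ^ʷ-rotate c t (suc k) = cong (c ∷_) (begin
    (t ++ (c ∷ t) ^ʷ k) ++ [ c ]      ≡⟨ ++-assoc t _ [ c ] ⟩
    t ++ (c ∷ t) ^ʷ k ++ [ c ]        ≡⟨ cong (t ++_) (^ʷ-rotate c t k) ⟩
    t ++ c ∷ (t ++ [ c ]) ^ʷ k        ≡⟨ ++-assoc t [ c ] _ ⟨
    (t ++ [ c ]) ++ (t ++ [ c ]) ^ʷ k ∎)
    where open ≡-Reasoning

  -- Rotating one letter at a time: c u ⋅ v = (c t)ᵏ gives u ⋅ v c = (t c)ᵏ.
  rotation-of-power : ∀ u v (t : List X) k → u ++ v ≡ t ^ʷ k → ∃[ s ] v ++ u ≡ s ^ʷ k
  rotation-of-power []      v t       k       eq = t , trans (++-identityʳ v) eq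
  rotation-of-power (_ ∷ _) v t       zero    ()
  rotation-of-power (c ∷ u) v []      (suc k) eq with () ← trans eq ([]^ʷ k)
  rotation-of-power (c ∷ u) v (d ∷ t) (suc k) eq with refl , eq′ ← ∷-injective eq =
    Product.map₂ (trans (sym (++-assoc v [ c ] u))) (rotation-of-power u (v ++ [ c ]) (t ++ [ c ]) (suc k) shifted)
    where
    open ≡-Reasoning
    shifted : u ++ v ++ [ c ] ≡ (t ++ [ c ]) ^ʷ suc k
    shifted = begin
      u ++ v ++ [ c ]              ≡⟨ ++-assoc u v [ c ] ⟨
      (u ++ v) ++ [ c ]            ≡⟨ cong (_++ [ c ]) eq′ ⟩
      (t ++ (c ∷ t) ^ʷ k) ++ [ c ] ≡⟨ proj₂ (∷-injective (^ʷ-rotate c t (suc k))) ⟩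
      (t ++ [ c ]) ^ʷ suc k        ∎

  Conjugate-^ʷ : ∀ {w x t : List X} {k} → Conjugate w x → w ≡ t ^ʷ k → ∃[ s ] x ≡ s ^ʷ k
  Conjugate-^ʷ {t = t} {k} (u , v , refl , refl) = rotation-of-power u v t k

  Primitive-Conjugate : ∀ {w x : List X} → Primitive w → Conjugate w x → Primitive x
  Primitive-Conjugate (w≢[] , ¬power) w~x@(u , v , refl , refl) =
    (λ vu≡[] → w≢[] (cong₂ _++_ (++-conicalʳ v u vu≡[]) (++-conicalˡ v u vu≡[]))) ,
    λ (s , k , 2≤k , x≡) →
      ¬power (Product.map₂ (λ w≡ → k , 2≤k , w≡) (Conjugate-^ʷ {t = s} {k} (Conjugate-sym w~x) x≡))

  Primitive-replicate : ∀ i {x : X} → Primitive (replicate i x) → i ≡ 1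
  Primitive-replicate zero          (w≢[] , _)  = contradiction refl w≢[]
  Primitive-replicate (suc zero)    _           = refl
  Primitive-replicate (suc (suc i)) {x} (_ , ¬power) =
    contradiction ([ x ] , suc (suc i) , s≤s (s≤s z≤n) , replicate-^ʷ (suc (suc i)) x) ¬power

  Conjugate⇒↭ : ∀ {w x : List X} → Conjugate w x → w ↭ x
  Conjugate⇒↭ (u , v , refl , refl) = ↭-++-comm u v

module NyldonLikeTheory {A : Set} {G : List A → Set} {_≺_ : List A → List A → Set}
                        (NL : NyldonLike G _≺_) where
  open NyldonLike NL public renaming (trans to ≺-trans)

  _⪯_ : List A → List A → Set
  f ⪯ g = f ⟨ _≺_ ⟩⪯ g

  ≺-⪯-trans : ∀ {f g h} → G f → G g → G h → f ≺ g → g ⪯ h → f ≺ h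
  ≺-⪯-trans Gf Gg Gh f≺g (inj₁ g≺h) = ≺-trans Gf Gg Gh f≺g g≺h
  ≺-⪯-trans _  _  _  f≺g (inj₂ refl) = f≺g

  ⪯-≺-trans : ∀ {f g h} → G f → G g → G h → f ⪯ g → g ≺ h → f ≺ h
  ⪯-≺-trans Gf Gg Gh (inj₁ f≺g) g≺h = ≺-trans Gf Gg Gh f≺g g≺h
  ⪯-≺-trans _  _  _  (inj₂ refl) g≺h = g≺h

  ≺-asym : ∀ {f g} → G f → G g → f ≺ g → ¬ (g ≺ f)
  ≺-asym Gf Gg f≺g g≺f = irrefl Gf (≺-trans Gf Gg Gf f≺g g≺f)

  ≺-⪰-dichotomy : ∀ {f g} → G f → G g → f ≺ g ⊎ g ⪯ f
  ≺-⪰-dichotomy Gf Gg with total Gf Gg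
  ... | inj₁ f≺g          = inj₁ f≺g
  ... | inj₂ (inj₁ refl)  = inj₂ (inj₂ refl)
  ... | inj₂ (inj₂ g≺f)   = inj₂ (inj₁ g≺f)

  ≺-dec : ∀ {f g} → G f → G g → Dec (f ≺ g)
  ≺-dec Gf Gg with total Gf Gg
  ... | inj₁ f≺g         = yes f≺g
  ... | inj₂ (inj₁ refl) = no (irrefl Gf)
  ... | inj₂ (inj₂ g≺f)  = no (≺-asym Gg Gf g≺f)

  ≺-stable : ∀ {f g} → G f → G g → ¬ ¬ (f ≺ g) → f ≺ g
  ≺-stable Gf Gg = decidable-stable (≺-dec Gf Gg)

  single-factorization : ∀ {w} → G w → GFactorization G _≺_ w
  single-factorization {w} Gw =
    record { factors = [ w ] ; inG = Gw ∷ [] ; product = ++-identityʳ w ; sorted = [-] }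

  ¬proper-factorization : ∀ {w} → G w → ∀ fs → All G fs → Sorted _≺_ fs → concat fs ≡ w →
                          2 ≤ length fs → ⊥
  ¬proper-factorization Gw fs Gfs sorted refl 2≤ =
    proj₁ (factorChar (concat fs) (≤-trans 2≤ (length≤length-concat (All.map nonempty Gfs)))) Gw
      (record { factors = fs ; inG = Gfs ; product = refl ; sorted = sorted } , 2≤)

  G⇒single-factor : ∀ {w} → G w → ∀ fs → All G fs → Sorted _≺_ fs → concat fs ≡ w → fs ≡ [ w ]
  G⇒single-factor Gw []          _   _      refl = ⊥-elim (nonempty Gw refl)
  G⇒single-factor Gw (f ∷ [])    _   _      refl = cong [_] (sym (++-identityʳ f))
  G⇒single-factor Gw fs@(_ ∷ _ ∷ _) Gfs sorted eq =
    ⊥-elim (¬proper-factorization Gw fs Gfs sorted eq (s≤s (s≤s z≤n)))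

  -- Only double-negated, since membership in G is not assumed decidable.
  factorization-exists : ∀ {w} → w ≢ [] → ¬ ¬ GFactorization G _≺_ w
  factorization-exists {[]}            w≢[] = contradiction refl w≢[]
  factorization-exists {c ∷ []}        _ ¬F = ¬F (single-factorization (letters c))
  factorization-exists {w@(_ ∷ _ ∷ _)} _ ¬F =
    ¬F (single-factorization (proj₂ (factorChar w (s≤s (s≤s z≤n))) λ (F , _) → ¬F F))

  record SnocFactorization (w : List A) : Set where
    constructor snocFactorization
    field
      init    : List (List A)
      last    : List A
      init-G  : All G init
      last-G  : G last
      sorted  : Sorted _≺_ (init ∷ʳ last)
      product : concat init ++ last ≡ w

  snoc-factorization-exists : ∀ {w} → w ≢ [] → ¬ ¬ SnocFactorization w
  snoc-factorization-exists {w} w≢[] ¬S = factorization-exists w≢[] λ F →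
    split-last (GFactorization.factors F) (initLast _) (GFactorization.inG F)
               (GFactorization.sorted F) (GFactorization.product F)
    where
    split-last : ∀ fs → InitLast fs → All G fs → Sorted _≺_ fs → concat fs ≡ w → ⊥
    split-last .[]          []            _   _      eq = w≢[] (sym eq)
    split-last .(fs ∷ʳ l) (fs ∷ʳ′ l) Gfsl sorted eq with Gfs , Gl ← ∷ʳ⁻ Gfsl =
      ¬S (snocFactorization fs l Gfs Gl sorted (trans (sym (concat-∷ʳ fs l)) eq))

  Sorted-tail : ∀ {f fs} → Sorted _≺_ (f ∷ fs) → Sorted _≺_ fs
  Sorted-tail [-]          = []
  Sorted-tail (_ ∷ sorted) = sorted

  Sorted-++⁻ˡ : ∀ fs {gs} → Sorted _≺_ (fs ++ gs) → Sorted _≺_ fs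
  Sorted-++⁻ˡ []           _              = []
  Sorted-++⁻ˡ (_ ∷ [])     _              = [-]
  Sorted-++⁻ˡ (_ ∷ g ∷ fs) (f⪯g ∷ sorted) = f⪯g ∷ Sorted-++⁻ˡ (g ∷ fs) sorted

  Sorted-join : ∀ fs {l h t} → Sorted _≺_ (fs ∷ʳ l) → l ⪯ h → Sorted _≺_ (h ∷ t) →
                Sorted _≺_ (fs ++ l ∷ h ∷ t)
  Sorted-join []           _              l⪯h sorted′ = l⪯h ∷ sorted′
  Sorted-join (_ ∷ [])     (f⪯l ∷ [-])    l⪯h sorted′ = f⪯l ∷ l⪯h ∷ sorted′
  Sorted-join (_ ∷ g ∷ fs) (f⪯g ∷ sorted) l⪯h sorted′ = f⪯g ∷ Sorted-join (g ∷ fs) sorted l⪯h sorted′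

  SuffixesBelow : List A → Set
  SuffixesBelow g = ∀ {x s} → x ≢ [] → g ≡ x ++ s → G s → s ≺ g

  last-factor-≻-suffix : ∀ {g xs xt s} → G g → All G xs → G xt → Sorted _≺_ (xs ∷ʳ xt) → G s →
                         g ≡ concat xs ++ xt ++ s → s ≺ xt
  last-factor-≻-suffix {g} {xs} {xt} {s} Gg Gxs Gxt sorted Gs g≡ with ≺-⪰-dichotomy Gs Gxt
  ... | inj₁ s≺xt = s≺xt
  ... | inj₂ xt⪯s = ⊥-elim (¬proper-factorization Gg (xs ++ xt ∷ s ∷ []) (++⁺ Gxs (Gxt ∷ Gs ∷ []))
                             (Sorted-join xs sorted xt⪯s [-]) product (length-++-∷-∷ xs xt s []))
    where
    product : concat (xs ++ xt ∷ s ∷ []) ≡ g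
    product = begin
      concat (xs ++ xt ∷ s ∷ [])   ≡⟨ concat-++ xs _ ⟨
      concat xs ++ xt ++ s ++ []   ≡⟨ cong (λ v → concat xs ++ xt ++ v) (++-identityʳ s) ⟩
      concat xs ++ xt ++ s         ≡⟨ g≡ ⟨
      g                            ∎
      where open ≡-Reasoning

  ¬factorization-∷ʳ-≺ : ∀ {zs u s} → All G zs → G u → G s → Sorted _≺_ (zs ∷ʳ s) → concat zs ≡ u →
                        ¬ (s ≺ u)
  ¬factorization-∷ʳ-≺ {zs} Gzs Gu Gs sorted zs≡u s≺u
    with refl ← G⇒single-factor Gu zs Gzs (Sorted-++⁻ˡ zs sorted) zs≡u
    with u⪯s ∷ [-] ← sorted = irrefl Gu (⪯-≺-trans Gu Gs Gu u⪯s s≺u)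

  module _ {n} (below : ∀ {h} → length h < n → G h → SuffixesBelow h) where

    cut-inside-first∉G : ∀ {f nxt r q} → All G (f ∷ nxt) → Sorted _≺_ (f ∷ nxt) → nxt ≢ [] →
                         length f < n → f ≡ r ++ q → q ≢ [] → ¬ G (q ++ concat nxt)
    cut-inside-first∉G {nxt = []} _ _ nxt≢[] = contradiction refl nxt≢[]
    cut-inside-first∉G {f} {h ∷ t} {[]} Gfs sorted _ _ refl _ Gfnxt =
      ¬proper-factorization Gfnxt (f ∷ h ∷ t) Gfs sorted refl (s≤s (s≤s z≤n))
    cut-inside-first∉G {f} {h ∷ t} {r@(_ ∷ _)} {q} (Gf ∷ Gh ∷ Gt) (f⪯h ∷ sorted) _ |f|<n f≡rq q≢[] Gqnxt =
      snoc-factorization-exists q≢[] refine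
      where
      refine : ¬ SnocFactorization q
      refine (snocFactorization vs vk Gvs Gvk sorted′ q≡) =
        ¬proper-factorization Gqnxt (vs ++ vk ∷ h ∷ t) (++⁺ Gvs (Gvk ∷ Gh ∷ Gt))
          (Sorted-join vs sorted′ (inj₁ (≺-⪯-trans Gvk Gf Gh vk≺f f⪯h)) sorted) product
          (length-++-∷-∷ vs vk h t)
        where
        open ≡-Reasoning
        vk≺f : vk ≺ f
        vk≺f = below |f|<n Gf (λ ()) (begin
          f                      ≡⟨ f≡rq ⟩
          r ++ q                 ≡⟨ cong (r ++_) q≡ ⟨
          r ++ concat vs ++ vk   ≡⟨ ++-assoc r (concat vs) vk ⟨
          (r ++ concat vs) ++ vk ∎) Gvk
        product : concat (vs ++ vk ∷ h ∷ t) ≡ q ++ concat (h ∷ t)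
        product = begin
          concat (vs ++ vk ∷ h ∷ t)         ≡⟨ concat-++ vs _ ⟨
          concat vs ++ vk ++ concat (h ∷ t) ≡⟨ ++-assoc (concat vs) vk _ ⟨
          (concat vs ++ vk) ++ concat (h ∷ t) ≡⟨ cong (_++ concat (h ∷ t)) q≡ ⟩
          q ++ concat (h ∷ t)               ∎

    sorted-suffix∉G : ∀ fs {rest r p} → All G (fs ++ rest) → Sorted _≺_ (fs ++ rest) → rest ≢ [] →
                      length (concat fs) < n → concat fs ≡ r ++ p → p ≢ [] → ¬ G (p ++ concat rest)
    sorted-suffix∉G [] {r = r} {p} _ _ _ _ []≡rp p≢[] _ = p≢[] (++-conicalʳ r p (sym []≡rp))
    sorted-suffix∉G (f ∷ fs) {rest} {r} {p} (Gf ∷ Gfs) sorted rest≢[] |ffs|<n ffs≡rp p≢[]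
      with levi f (concat fs) r p ffs≡rp
    ... | inj₁ (_ , _ , fs≡qp) =
          sorted-suffix∉G fs Gfs (Sorted-tail sorted) rest≢[]
            (≤-<-trans (length-++-≤ʳ (concat fs) {f}) |ffs|<n) fs≡qp p≢[]
    ... | inj₂ ([] , _ , p≡fs) =
          sorted-suffix∉G fs Gfs (Sorted-tail sorted) rest≢[]
            (≤-<-trans (length-++-≤ʳ (concat fs) {f}) |ffs|<n) (sym p≡fs) p≢[]
    ... | inj₂ (q@(_ ∷ _) , f≡rq , p≡qfs) = λ Gprest →
          cut-inside-first∉G (Gf ∷ Gfs) sorted (λ e → rest≢[] (++-conicalʳ fs rest e))
            (≤-<-trans (length-++-≤ˡ f) |ffs|<n) f≡rq (λ ()) (subst G product Gprest)
      where
      product : p ++ concat rest ≡ q ++ concat (fs ++ rest)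
      product = begin
        p ++ concat rest                ≡⟨ cong (_++ concat rest) p≡qfs ⟩
        (q ++ concat fs) ++ concat rest ≡⟨ ++-assoc q (concat fs) (concat rest) ⟩
        q ++ concat fs ++ concat rest   ≡⟨ cong (q ++_) (concat-++ fs rest) ⟩
        q ++ concat (fs ++ rest)        ∎
        where open ≡-Reasoning

    last-factor-extends-suffix : ∀ {zs z u s} → All G zs → G z → Sorted _≺_ (zs ∷ʳ z) →
                                 concat zs ++ z ≡ u ++ s → length (u ++ s) < n → G u → G s → s ≺ u →
                                 ∃[ p ] p ≢ [] × u ≡ concat zs ++ p × s ≺ z
    last-factor-extends-suffix {zs} {z} {u} {s} Gzs Gz sorted eq |us|<n Gu Gs s≺u
      with levi (concat zs) z u s eq
    ... | inj₁ ([] , u≡zs , refl) =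
          ⊥-elim (¬factorization-∷ʳ-≺ Gzs Gu Gs sorted (sym (trans u≡zs (++-identityʳ _))) s≺u)
    ... | inj₁ (p@(_ ∷ _) , u≡zsp , z≡ps) =
          p , (λ ()) , u≡zsp , below (≤-<-trans (++≡⇒length-≤ʳ (concat zs) (sym eq)) |us|<n) Gz (λ ()) z≡ps Gs
    ... | inj₂ ([] , zs≡u , refl) =
          ⊥-elim (¬factorization-∷ʳ-≺ Gzs Gu Gs sorted (trans zs≡u (++-identityʳ u)) s≺u)
    ... | inj₂ (p@(_ ∷ _) , zs≡up , s≡pz) =
          ⊥-elim (sorted-suffix∉G zs (++⁺ Gzs (Gz ∷ [])) sorted (λ ()) |zs|<n zs≡up (λ ())
                    (subst G (trans s≡pz (cong (p ++_) (sym (++-identityʳ z)))) Gs))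
      where
      |zs|<n : length (concat zs) < n
      |zs|<n = ≤-<-trans (++≡⇒length-≤ˡ (concat zs) (sym eq)) |us|<n

    suffix-≺-of-long-prefix : ∀ {g xs xt s} → G g → length g ≤ n → All G xs → xs ≢ [] → G xt →
                              Sorted _≺_ (xs ∷ʳ xt) → G s → g ≡ concat xs ++ xt ++ s →
                              (∀ {x′ z} → length x′ < length (concat xs ++ xt) → x′ ≢ [] → g ≡ x′ ++ z →
                                 G z → z ≺ g) →
                              ¬ ¬ (s ≺ g)
    suffix-≺-of-long-prefix {xs = []} _ _ _ xs≢[] = contradiction refl xs≢[]
    suffix-≺-of-long-prefix {g} {xs@(y ∷ _)} {xt} {s}
                            Gg |g|≤n Gxs@(Gy ∷ _) _ Gxt sorted Gs g≡ shorter-prefix s⊀g =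
      snoc-factorization-exists (λ e → nonempty Gxt (++-conicalˡ xt s e)) refine
      where
      open ≡-Reasoning
      concat-xs≢[] : concat xs ≢ []
      concat-xs≢[] e = nonempty Gy (++-conicalˡ y _ e)
      refine : ¬ SnocFactorization (xt ++ s)
      refine (snocFactorization zs z Gzs Gz sorted′ zsz≡xts)
        with last-factor-extends-suffix Gzs Gz sorted′ zsz≡xts
               (<-≤-trans (++≡⇒length-<ʳ (concat xs) g≡ concat-xs≢[]) |g|≤n) Gxt Gs
               (last-factor-≻-suffix Gg Gxs Gxt sorted Gs g≡)
      ... | p , p≢[] , xt≡zsp , s≺z =
        s⊀g (≺-trans Gs Gz Gg s≺z (shorter-prefix |x′|<|x| x′≢[] g≡x′z Gz))
        where
        x′ = concat xs ++ concat zs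
        x′≢[] : x′ ≢ []
        x′≢[] e = concat-xs≢[] (++-conicalˡ (concat xs) _ e)
        g≡x′z : g ≡ x′ ++ z
        g≡x′z = begin
          g                           ≡⟨ g≡ ⟩
          concat xs ++ xt ++ s        ≡⟨ cong (concat xs ++_) zsz≡xts ⟨
          concat xs ++ concat zs ++ z ≡⟨ ++-assoc (concat xs) (concat zs) z ⟨
          x′ ++ z                     ∎
        |x′|<|x| : length x′ < length (concat xs ++ xt)
        |x′|<|x| = ++≡⇒length-<ˡ x′ (begin
          concat xs ++ xt             ≡⟨ cong (concat xs ++_) xt≡zsp ⟩
          concat xs ++ concat zs ++ p ≡⟨ ++-assoc (concat xs) (concat zs) p ⟨
          x′ ++ p                     ∎) p≢[]

  suffix-≺-of-G-prefix : ∀ {g x s} → G g → G x → G s → g ≡ x ++ s → s ≺ g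
  suffix-≺-of-G-prefix Gg Gx Gs g≡xs =
    ≺-trans Gs Gx Gg (last-factor-≻-suffix Gg [] Gx [-] Gs g≡xs)
      (subst (_ ≺_) (sym g≡xs) (prefixLess Gx Gs (subst G g≡xs Gg)))

  suffix-≺-acc : ∀ {g} → Acc _<_ (length g) → G g → SuffixesBelow g
  suffix-≺-acc {g} (acc below) Gg = from-prefix (<-wellFounded _)
    where
    from-prefix : ∀ {x s} → Acc _<_ (length x) → x ≢ [] → g ≡ x ++ s → G s → s ≺ g
    from-prefix {x} {s} (acc shorter) x≢[] g≡xs Gs =
      ≺-stable Gs Gg λ s⊀g → snoc-factorization-exists x≢[] λ where
        (snocFactorization [] xt _ Gxt _ refl) → s⊀g (suffix-≺-of-G-prefix Gg Gxt Gs g≡xs)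
        (snocFactorization xs@(_ ∷ _) xt Gxs Gxt sorted refl) →
          suffix-≺-of-long-prefix (λ lt → suffix-≺-acc (below lt)) Gg ≤-refl Gxs (λ ()) Gxt sorted Gs
            (trans g≡xs (++-assoc (concat xs) xt s)) (λ lt → from-prefix (shorter lt)) s⊀g

  suffix-≺ : ∀ {g} → G g → SuffixesBelow g
  suffix-≺ = suffix-≺-acc (<-wellFounded _)

  _⪯ˡ_ : A → A → Set
  b ⪯ˡ c = [ b ] ⪯ [ c ]

  minimum-letter : ∀ {w} → w ≢ [] → ∃[ a ] a ∈ w × All (a ⪯ˡ_) w
  minimum-letter {[]}             w≢[] = contradiction refl w≢[]
  minimum-letter {c ∷ []}         _    = c , here refl , inj₂ refl ∷ []
  minimum-letter {c ∷ w@(_ ∷ _)}  _ with m , m∈ , m⪯ ← minimum-letter {w} (λ ())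
    with ≺-⪰-dichotomy (letters c) (letters m)
  ... | inj₁ c≺m =
    c , here refl , inj₂ refl ∷ All.map (λ {e} → inj₁ ∘ ≺-⪯-trans (letters c) (letters m) (letters e) c≺m) m⪯
  ... | inj₂ m⪯c = m , there m∈ , m⪯c ∷ m⪯

ProperFactorization : {A : Set} → (List A → Set) → (List A → List A → Set) → List A → Set
ProperFactorization G _≺_ w = Σ (GFactorization G _≺_ w) λ F → numFactors F ≥ 2

module _ {X Y : Set} {R : List Y → List Y → Set} (h : List X → List Y) where

  Sorted-map⁺ : ∀ {us} → Sorted (R on h) us → Sorted R (map h us)
  Sorted-map⁺ []                  = []
  Sorted-map⁺ [-]                 = [-]
  Sorted-map⁺ (inj₁ u<v ∷ sorted) = inj₁ u<v ∷ Sorted-map⁺ sorted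
  Sorted-map⁺ (inj₂ refl ∷ sorted) = inj₂ refl ∷ Sorted-map⁺ sorted

  Sorted-map⁻ : (∀ {u v} → h u ≡ h v → u ≡ v) → ∀ us → Sorted R (map h us) → Sorted (R on h) us
  Sorted-map⁻ _   []           _                   = []
  Sorted-map⁻ _   (_ ∷ [])     _                   = [-]
  Sorted-map⁻ inj (_ ∷ v ∷ us) (inj₁ u<v ∷ sorted) = inj₁ u<v ∷ Sorted-map⁻ inj (v ∷ us) sorted
  Sorted-map⁻ inj (_ ∷ v ∷ us) (inj₂ eq ∷ sorted)   = inj₂ (inj eq) ∷ Sorted-map⁻ inj (v ∷ us) sorted

module Elimination {A : Set} {G : List A → Set} {_≺_ : List A → List A → Set}
                   (NL : NyldonLike G _≺_) (a : A) where
  open NyldonLikeTheory NL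

  Above : List A → Set
  Above = All (a ⪯ˡ_)

  NoLeadingA : List A → Set
  NoLeadingA w = ∀ y → w ≢ a ∷ y

  a⪯G-word : ∀ {g} → G g → Above g → [ a ] ⪯ g
  a⪯G-word {g} Gg above with initLast g
  ... | []               = ⊥-elim (nonempty Gg refl)
  ... | [] ∷ʳ′ c         with a⪯c ∷ [] ← above = a⪯c
  ... | (d ∷ g′) ∷ʳ′ c   =
    inj₁ (⪯-≺-trans (letters a) (letters c) Gg (proj₂ (∷ʳ⁻ {xs = d ∷ g′} above))
                    (suffix-≺ Gg {d ∷ g′} (λ ()) refl (letters c)))

  G-word≮a : ∀ {g} → G g → Above g → ¬ (g ≺ [ a ])
  G-word≮a Gg above g≺a with a⪯G-word Gg above
  ... | inj₁ a≺g  = ≺-asym Gg (letters a) g≺a a≺g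
  ... | inj₂ refl = irrefl Gg g≺a

  a∷y∈G⇒y≡[] : ∀ {y} → Above y → G (a ∷ y) → y ≡ []
  a∷y∈G⇒y≡[] {[]}    _     _   = refl
  a∷y∈G⇒y≡[] {y@(_ ∷ _)} above Gay = ⊥-elim (factorization-exists {y} (λ ()) λ F →
    extend (GFactorization.factors F) (GFactorization.inG F) (GFactorization.sorted F) (GFactorization.product F))
    where
    extend : ∀ fs → All G fs → Sorted _≺_ fs → concat fs ≡ y → ⊥
    extend []       _          _      ()
    extend (f ∷ fs) (Gf ∷ Gfs) sorted eq =
      ¬proper-factorization Gay ([ a ] ∷ f ∷ fs) (letters a ∷ Gf ∷ Gfs)
        (a⪯G-word Gf (++⁻ˡ f (subst Above (sym eq) above)) ∷ sorted) (cong (a ∷_) eq) (s≤s (s≤s z≤n))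

  NoLeadingA-++ : ∀ {f} g → f ≢ [] → NoLeadingA f → NoLeadingA (f ++ g)
  NoLeadingA-++ {[]}    _ f≢[] _  = contradiction refl f≢[]
  NoLeadingA-++ {_ ∷ f} g _    na y eq with refl , _ ← ∷-injective eq = na f refl

  NoLeadingA-++⁻ : ∀ {f} g → f ≢ [] → NoLeadingA (f ++ g) → NoLeadingA f
  NoLeadingA-++⁻ {[]}    _ f≢[] _  = contradiction refl f≢[]
  NoLeadingA-++⁻ {_ ∷ _} g _    na y refl = na (y ++ g) refl

  next-factor-NoLeadingA : ∀ {f g} → G f → G g → f ⪯ g → Above f → Above g → NoLeadingA f → NoLeadingA g
  next-factor-NoLeadingA Gf Gg f⪯g above-f (_ ∷ above-y) na-f y refl
    with refl ← a∷y∈G⇒y≡[] above-y Gg with f⪯g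
  ... | inj₁ f≺a  = G-word≮a Gf above-f f≺a
  ... | inj₂ refl = na-f [] refl

  factors-NoLeadingA : ∀ f fs → All G (f ∷ fs) → Sorted _≺_ (f ∷ fs) → Above (concat (f ∷ fs)) →
                       NoLeadingA f → All NoLeadingA (f ∷ fs)
  factors-NoLeadingA f []       _               _              _     na-f = na-f ∷ []
  factors-NoLeadingA f (g ∷ fs) (Gf ∷ Gg ∷ Gfs) (f⪯g ∷ sorted) above na-f =
    na-f ∷ factors-NoLeadingA g fs (Gg ∷ Gfs) sorted above-rest
             (next-factor-NoLeadingA Gf Gg f⪯g (++⁻ˡ f above) (++⁻ˡ g above-rest) na-f)
    where
    above-rest : Above (concat (g ∷ fs))
    above-rest = ++⁻ʳ f above

  NoLeadingA-concat : ∀ fs → All G fs → All NoLeadingA fs → NoLeadingA (concat fs)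
  NoLeadingA-concat []       _          _           _ ()
  NoLeadingA-concat (f ∷ fs) (Gf ∷ _)   (na-f ∷ _)  = NoLeadingA-++ (concat fs) (nonempty Gf) na-f

  -- Lazard elimination of the letter a: a word with all letters ⪰ a and not starting
  -- with a is uniquely a product of blocks b aⁱ with b ≻ a.  The condition b ≻ a is
  -- kept as a decided boolean, so that equal blocks have equal proofs (flat-injective).
  Block : Set
  Block = Σ (A × ℕ) λ (b , _) → True (≺-dec (letters a) (letters b))

  block-exponent : Block → ℕ
  block-exponent ((_ , i) , _) = i

  embed : Block → List A
  embed ((b , i) , _) = b ∷ replicate i a

  flat : List Block → List A
  flat = concatMap embed

  flat-++ : ∀ U V → flat (U ++ V) ≡ flat U ++ flat V
  flat-++ = concatMap-++ embed

  flat≡[] : ∀ {U} → flat U ≡ [] → U ≡ []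
  flat≡[] {[]} _ = refl

  NoLeadingA-flat : ∀ U → NoLeadingA (flat U)
  NoLeadingA-flat []                        _ ()
  NoLeadingA-flat (((b , _) , a≺b) ∷ _) _ eq =
    irrefl (letters a) (subst (λ c → [ a ] ≺ [ c ]) (∷-injectiveˡ eq) (toWitness a≺b))

  Above-flat : ∀ U → Above (flat U)
  Above-flat []                        = []
  Above-flat (((_ , i) , a≺b) ∷ U) = inj₁ (toWitness a≺b) ∷ ++⁺ (replicate⁺ i (inj₂ refl)) (Above-flat U)

  replicate-++-cancel : ∀ i j {X Y} → NoLeadingA X → NoLeadingA Y →
                        replicate i a ++ X ≡ replicate j a ++ Y → i ≡ j × X ≡ Y
  replicate-++-cancel zero    zero    _    _    eq = refl , eq
  replicate-++-cancel zero    (suc j) na-X _    eq = contradiction eq (na-X _)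
  replicate-++-cancel (suc i) zero    _    na-Y eq = contradiction (sym eq) (na-Y _)
  replicate-++-cancel (suc i) (suc j) na-X na-Y eq
    with refl , refl ← replicate-++-cancel i j na-X na-Y (proj₂ (∷-injective eq)) = refl , refl

  flat-injective : ∀ {U V} → flat U ≡ flat V → U ≡ V
  flat-injective {[]} {[]} _ = refl
  flat-injective {((b , i) , p) ∷ U} {((c , j) , q) ∷ V} eq
    with refl , eq′ ← ∷-injective eq
    with refl , eq″ ← replicate-++-cancel i j (NoLeadingA-flat U) (NoLeadingA-flat V) eq′
    with refl ← T-irrelevant p q
    with refl ← flat-injective {U} {V} eq″ = refl

  flat-split : ∀ U {f rest} → flat U ≡ f ++ rest → NoLeadingA rest →
               ∃[ U₁ ] ∃[ U₂ ] U ≡ U₁ ++ U₂ × flat U₁ ≡ f × flat U₂ ≡ rest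
  flat-split U {[]} eq _ = [] , U , refl , refl , eq
  flat-split (β ∷ U) {f@(_ ∷ f′)} {rest} eq na-rest with levi (embed β) (flat U) f rest eq
  ... | inj₁ (q , f≡βq , U≡qrest)
    with U₁ , U₂ , refl , refl , U₂≡rest ← flat-split U {q} U≡qrest na-rest =
    β ∷ U₁ , U₂ , refl , sym f≡βq , U₂≡rest
  ... | inj₂ ([] , β≡f , rest≡U) =
    [ β ] , U , refl , trans (++-identityʳ (embed β)) (trans β≡f (++-identityʳ f)) , sym rest≡U
  ... | inj₂ (q@(_ ∷ _) , β≡fq , rest≡qU)
    with a-q ∷ _ ← ++⁻ʳ f′ (subst (All (_≡ a)) (proj₂ (∷-injective β≡fq))
                                  (replicate⁺ (block-exponent β) refl)) =
    contradiction (trans rest≡qU (cong (_∷ _) a-q)) (na-rest _)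

  flat-concat : ∀ Us → concat (map flat Us) ≡ flat (concat Us)
  flat-concat []       = refl
  flat-concat (U ∷ Us) = trans (cong (flat U ++_) (flat-concat Us)) (sym (flat-++ U (concat Us)))

  lift-factors : ∀ fs {U} → All G fs → All NoLeadingA fs → concat fs ≡ flat U →
                 ∃[ Us ] map flat Us ≡ fs × concat Us ≡ U
  lift-factors []       _          _            eq = [] , refl , sym (flat≡[] (sym eq))
  lift-factors (f ∷ fs) {U} (_ ∷ Gfs) (_ ∷ na-fs) eq
    with U₁ , U₂ , refl , refl , U₂≡fs ← flat-split U {f} (sym eq) (NoLeadingA-concat fs Gfs na-fs)
    with Us , refl , refl ← lift-factors fs {U₂} Gfs na-fs (sym U₂≡fs) = U₁ ∷ Us , refl , refl

  G′ : List Block → Set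
  G′ = G ∘ flat

  _≺′_ : List Block → List Block → Set
  _≺′_ = _≺_ on flat

  lower-factorization : ∀ {U} → (F : GFactorization G′ _≺′_ U) →
                        Σ (GFactorization G _≺_ (flat U)) λ F′ → numFactors F′ ≡ numFactors F
  lower-factorization {U} F =
    record { factors = map flat Us
           ; inG     = map⁺ (GFactorization.inG F)
           ; product = trans (flat-concat Us) (cong flat (GFactorization.product F))
           ; sorted  = Sorted-map⁺ flat (GFactorization.sorted F) } ,
    length-map flat Us
    where Us = GFactorization.factors F

  flat-factors-NoLeadingA : ∀ U fs → All G fs → Sorted _≺_ fs → concat fs ≡ flat U → All NoLeadingA fs
  flat-factors-NoLeadingA U []       _             _      _  = []
  flat-factors-NoLeadingA U (f ∷ fs) Gfs@(Gf ∷ _) sorted eq =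
    factors-NoLeadingA f fs Gfs sorted (subst Above (sym eq) (Above-flat U))
      (NoLeadingA-++⁻ (concat fs) (nonempty Gf) (subst NoLeadingA (sym eq) (NoLeadingA-flat U)))

  lift-factorization : ∀ {U} → (F : GFactorization G _≺_ (flat U)) →
                       Σ (GFactorization G′ _≺′_ U) λ F′ → numFactors F′ ≡ numFactors F
  lift-factorization {U} record { factors = fs ; inG = Gfs ; product = eq ; sorted = sorted }
    with Us , Us≡fs , refl ← lift-factors fs {U} Gfs (flat-factors-NoLeadingA U fs Gfs sorted eq) eq =
    record { factors = Us
           ; inG     = map⁻ (subst (All G) (sym Us≡fs) Gfs)
           ; product = refl
           ; sorted  = Sorted-map⁻ flat flat-injective Us (subst (Sorted _≺_) (sym Us≡fs) sorted) } ,
    trans (sym (length-map flat Us)) (cong length Us≡fs)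

  lower-proper : ∀ {U} → ProperFactorization G′ _≺′_ U → ProperFactorization G _≺_ (flat U)
  lower-proper (F , 2≤) with F′ , same ← lower-factorization F = F′ , subst (2 ≤_) (sym same) 2≤

  lift-proper : ∀ {U} → ProperFactorization G _≺_ (flat U) → ProperFactorization G′ _≺′_ U
  lift-proper (F , 2≤) with F′ , same ← lift-factorization F = F′ , subst (2 ≤_) (sym same) 2≤

  G′⇒≢[] : ∀ {U} → G′ U → U ≢ []
  G′⇒≢[] GU U≡[] = nonempty GU (cong flat U≡[])

  length≤length-flat : ∀ U → length U ≤ length (flat U)
  length≤length-flat []                = z≤n
  length≤length-flat (((_ , i) , _) ∷ U) =
    s≤s (≤-trans (length≤length-flat U) (length-++-≤ʳ (flat U) {replicate i a}))

  singleton-block∈G : ∀ β → G′ [ β ]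
  singleton-block∈G ((b , zero) , _) = letters b
  singleton-block∈G β@((_ , suc _) , _) = proj₂ (factorChar (flat [ β ]) (s≤s (s≤s z≤n))) λ P →
    too-many (lift-proper P)
    where
    too-many : ¬ ProperFactorization G′ _≺′_ [ β ]
    too-many (F , 2≤) with ≤-trans 2≤ (subst (λ v → numFactors F ≤ length v) (GFactorization.product F)
                                      (length≤length-concat (All.map G′⇒≢[] (GFactorization.inG F))))
    ... | s≤s ()

  eliminated : NyldonLike G′ _≺′_
  eliminated = record
    { nonempty   = G′⇒≢[]
    ; irrefl     = irrefl
    ; trans      = ≺-trans
    ; total      = λ GU GV → Sum.map₂ (Sum.map₁ flat-injective) (total GU GV)
    ; letters    = singleton-block∈G
    ; factorChar = λ U 2≤|U| → let 2≤|flatU| = ≤-trans 2≤|U| (length≤length-flat U) in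
        (λ GU P → proj₁ (factorChar (flat U) 2≤|flatU|) GU (lower-proper P)) ,
        (λ ¬P → proj₂ (factorChar (flat U) 2≤|flatU|) (¬P ∘ lift-proper))
    ; prefixLess = λ {U} {V} GU GV GUV →
        subst (flat U ≺_) (sym (flat-++ U V)) (prefixLess GU GV (subst G (flat-++ U V) GUV))
    }

  a-block-decomposition : ∀ {w} → Above w → ∃[ i ] ∃[ U ] w ≡ replicate i a ++ flat U
  a-block-decomposition []                = 0 , [] , refl
  a-block-decomposition {c ∷ _} (a⪯c ∷ above) with i , U , refl ← a-block-decomposition above with a⪯c
  ... | inj₁ a≺c     = 0 , ((c , i) , fromWitness a≺c) ∷ U , refl
  ... | inj₂ [a]≡[c] with refl ← ∷-injectiveˡ [a]≡[c] = suc i , U , refl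

  flat-surjective : ∀ {w} → Above w → NoLeadingA w → ∃[ U ] flat U ≡ w
  flat-surjective above na with a-block-decomposition above
  ... | zero  , U , refl = U , refl
  ... | suc _ , _ , refl = contradiction refl (na _)

  length-flat-< : ∀ U → a ∈ flat U → length U < length (flat U)
  length-flat-< (((_ , _) , a≺b) ∷ _) (here a≡b) =
    contradiction (subst (λ c → [ a ] ≺ [ c ]) (sym a≡b) (toWitness a≺b)) (irrefl (letters a))
  length-flat-< (((_ , zero) , _) ∷ U) (there a∈U) = s≤s (length-flat-< U a∈U)
  length-flat-< (((_ , suc i) , _) ∷ U) (there _) =
    s≤s (s≤s (≤-trans (length≤length-flat U) (length-++-≤ʳ (flat U) {replicate i a})))

  flat-^ʷ : ∀ V k → flat (V ^ʷ k) ≡ flat V ^ʷ k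
  flat-^ʷ V zero    = refl
  flat-^ʷ V (suc k) = trans (flat-++ V (V ^ʷ k)) (cong (flat V ++_) (flat-^ʷ V k))

  proper-prefix-NoLeadingA : ∀ {u v} → Above (u ++ v) → v ≢ [] → G (u ++ v) → NoLeadingA u
  proper-prefix-NoLeadingA {v = v} (_ ∷ above) v≢[] Gu y refl = v≢[] (++-conicalʳ y v (a∷y∈G⇒y≡[] above Gu))

  Conjugate-flat : ∀ {U X} → Conjugate U X → Conjugate (flat U) (flat X)
  Conjugate-flat (P , Q , refl , refl) = flat P , flat Q , flat-++ P Q , flat-++ Q P

  Primitive-flat⁻ : ∀ {U} → Primitive (flat U) → Primitive U
  Primitive-flat⁻ (flatU≢[] , ¬power) =
    (λ U≡[] → flatU≢[] (cong flat U≡[])) ,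
    λ (V , k , 2≤k , U≡) → ¬power (flat V , k , 2≤k , trans (cong flat U≡) (flat-^ʷ V k))

  rotation-descends : ∀ {u v} → a ∈ u ++ v → Above (u ++ v) → u ≢ [] → v ≢ [] →
                      G (u ++ v) → G (v ++ u) →
                      ∃[ U ] ∃[ V ] length (U ++ V) < length (u ++ v) × U ≢ [] × V ≢ [] ×
                                   G′ (U ++ V) × G′ (V ++ U)
  rotation-descends {u} {v} a∈uv above u≢[] v≢[] Guv Gvu
    with U , refl ← flat-surjective (++⁻ˡ u above) (proper-prefix-NoLeadingA above v≢[] Guv)
    with V , refl ← flat-surjective (++⁻ʳ u above)
                      (proper-prefix-NoLeadingA (All-resp-↭ (↭-++-comm u v) above) u≢[] Gvu)
    = U , V , shorter , (u≢[] ∘ cong flat) , (v≢[] ∘ cong flat)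
    , subst G (sym (flat-++ U V)) Guv , subst G (sym (flat-++ V U)) Gvu
    where
    shorter : length (U ++ V) < length (flat U ++ flat V)
    shorter = subst (λ w → length (U ++ V) < length w) (flat-++ U V)
                (length-flat-< (U ++ V) (subst (a ∈_) (sym (flat-++ U V)) a∈uv))

  primitive-descends : ∀ {w} → a ∈ w → Above w → Primitive w →
                       w ≡ [ a ] ⊎ ∃[ U ] length U < length w × Primitive U ×
                                       (∀ {X} → Conjugate U X → G′ X → ∃[ x ] Conjugate w x × G x)
  primitive-descends a∈w above prim with a-block-decomposition above
  ... | i , [] , refl with refl ← Primitive-replicate i (subst Primitive (++-identityʳ _) prim) = inj₁ refl
  ... | i , U@(_ ∷ _) , refl
    with U₁ , U₁≡ ← flat-surjective {flat U ++ replicate i a}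
                      (All-resp-↭ (↭-++-comm (replicate i a) (flat U)) above)
                      (NoLeadingA-++ (replicate i a) (λ ()) (NoLeadingA-flat U))
    = inj₂ (U₁ , shorter , Primitive-flat⁻ (subst Primitive (sym U₁≡) (Primitive-Conjugate prim w~w₁)) , lift)
    where
    w~w₁ : Conjugate (replicate i a ++ flat U) (flat U ++ replicate i a)
    w~w₁ = replicate i a , flat U , refl , refl
    shorter : length U₁ < length (replicate i a ++ flat U)
    shorter = subst (length U₁ <_) (trans (cong length U₁≡) (sym (↭-length (Conjugate⇒↭ w~w₁))))
                (length-flat-< U₁ (subst (a ∈_) (sym U₁≡) (∈-resp-↭ (Conjugate⇒↭ w~w₁) a∈w)))
    lift : ∀ {X} → Conjugate U₁ X → G′ X → ∃[ x ] Conjugate (replicate i a ++ flat U) x × G x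
    lift {X} U₁~X GX =
      flat X , Conjugate-trans w~w₁ (subst (λ z → Conjugate z (flat X)) U₁≡ (Conjugate-flat U₁~X)) , GX

open NyldonLikeTheory using (minimum-letter)
open Elimination using (eliminated; rotation-descends; primitive-descends)

rotation∉G : ∀ {A : Set} {G : List A → Set} {_≺_ : List A → List A → Set} → NyldonLike G _≺_ →
             ∀ {u v} → Acc _<_ (length (u ++ v)) → u ≢ [] → v ≢ [] → G (u ++ v) → ¬ G (v ++ u)
rotation∉G NL {u} {v} (acc smaller) u≢[] v≢[] Guv Gvu =
  let a , a∈uv , above = minimum-letter NL (u≢[] ∘ ++-conicalˡ u v)
      U , V , shorter , U≢[] , V≢[] , GUV , GVU = rotation-descends NL a a∈uv above u≢[] v≢[] Guv Gvu
  in rotation∉G (eliminated NL a) (smaller shorter) U≢[] V≢[] GUV GVU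

conjugate-in-G : ∀ {A : Set} {G : List A → Set} {_≺_ : List A → List A → Set} → NyldonLike G _≺_ →
                 ∀ {w} → Acc _<_ (length w) → Primitive w → ∃[ x ] Conjugate w x × G x
conjugate-in-G NL (acc smaller) prim with a , a∈w , above ← minimum-letter NL (proj₁ prim)
  with primitive-descends NL a a∈w above prim
... | inj₁ refl = [ a ] , Conjugate-refl [ a ] , NyldonLike.letters NL a
... | inj₂ (U , shorter , primU , lift) =
  let X , U~X , GX = conjugate-in-G (eliminated NL a) (smaller shorter) primU in lift U~X GX

module _ {A : Set} {G : List A → Set} {_≺_ : List A → List A → Set} (NL : NyldonLike G _≺_) where

  conjugate-G-words-equal : ∀ {x y} → G x → G y → Conjugate x y → x ≡ y
  conjugate-G-words-equal _  _  ([] , v , refl , refl) = sym (++-identityʳ v)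
  conjugate-G-words-equal _  _  (u@(_ ∷ _) , [] , refl , refl) = ++-identityʳ u
  conjugate-G-words-equal Gx Gy (u@(_ ∷ _) , v@(_ ∷ _) , refl , refl) =
    contradiction Gy (rotation∉G NL {u} {v} (<-wellFounded _) (λ ()) (λ ()) Gx)

  power∉G : ∀ u k → 2 ≤ k → u ≢ [] → ¬ G (u ^ʷ k)
  power∉G u (suc (suc k)) (s≤s (s≤s _)) u≢[] Gw =
    rotation∉G NL (<-wellFounded _) u≢[] (u≢[] ∘ ++-conicalˡ u _) Gw
      (subst G (sym (^ʷ-comm u (suc k))) Gw)

theorem3p7 : {A : Set} → Alphabet A →
  (G : List A → Set) → (_≺_ : List A → List A → Set) → NyldonLike G _≺_ →
    (∀ (w : List A) → Primitive w →
       Σ (List A) λ x → (Conjugate w x × G x) ×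
         (∀ (y : List A) → Conjugate w y → G y → y ≡ x))
  × (∀ (w : List A) → w ≢ [] → ¬ Primitive w → ¬ G w)
theorem3p7 {A} _ G _≺_ NL = unique-conjugate , non-primitive∉G
  where
  unique-conjugate : ∀ w → Primitive w →
                     Σ (List A) λ x → (Conjugate w x × G x) × (∀ y → Conjugate w y → G y → y ≡ x)
  unique-conjugate w prim =
    let x , w~x , Gx = conjugate-in-G NL (<-wellFounded _) prim
    in x , (w~x , Gx) , λ y w~y Gy → conjugate-G-words-equal NL Gy Gx (Conjugate-trans (Conjugate-sym w~y) w~x)
  non-primitive∉G : ∀ w → w ≢ [] → ¬ Primitive w → ¬ G w
  non-primitive∉G w w≢[] ¬prim Gw = ¬prim (w≢[] , λ (u , k , 2≤k , w≡uᵏ) →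
    power∉G NL u k 2≤k (λ { refl → w≢[] (trans w≡uᵏ ([]^ʷ k)) }) (subst G w≡uᵏ Gw))
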